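{- Let $k$ be a finite field with $q$ elements, $n$ a positive integer dividing $q-1$, and $\bm{\mu}_n\subset k^\times$ the group of $n$-th roots of unity. View $k$ as a finite free pointed $\bm{\mu}_n$-set (marked point $0$, action by multiplication). Let $a\in k^{\times}$ and $m_{a}:k\rightarrow k$, $x\mapsto xa$. Then $m_{a}$ is an automorphism of $k$ as a finite free pointed $\bm{\mu}_{n}$-set, and the image of $m_{a}$ in $\mathrm{Aut}(k)^{ab}\cong\bm{\mu}_n\times\mathbf{Z}/2\mathbf{Z}$ is $(a^{\frac{q-1}{n}},\varepsilon)$ for some $\varepsilon\in\{\pm 1\}$.
   Context: A finite free pointed $\bm{\mu}_n$-set is a finite pointed set $(X,*)$ with a $\bm{\mu}_n$-action fixing $*$ and free on $X\smallsetminus\{*\}$; $\mathrm{Aut}(X)$ is the group of $\bm{\mu}_n$-equivariant bijections fixing $*$. Choosing representatives $x_1,\dots,x_t$ of the $\bm{\mu}_n$-orbits in $X\smallsetminus\{*\}$, each $f\in\mathrm{Aut}(X)$ satisfies $f(x_i)=\mu_f(i)x_{\sigma_f(i)}$ for unique $\mu_f(i)\in\bm{\mu}_n$ and a unique permutation $\sigma_f$ of the orbits. The identification $\mathrm{Aut}(X)^{ab}\cong\bm{\mu}_n\times\mathbf{Z}/2\mathbf{Z}=\bm{\mu}_n\times\{\pm1\}$ is induced by $f\mapsto(\prod_i\mu_f(i),\mathrm{sgn}(\sigma_f))$ (independent of the choice of representatives). -}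

module Defs where

open import Level using (Level; _⊔_)
open import Data.Nat as ℕ using (ℕ; zero; suc; _∸_; _%_)
open import Data.Fin as Fin using (Fin; _<?_)
open import Data.Product using (Σ; ∃; _×_; _,_)
open import Data.Sign using (Sign)
open import Function.Bundles using (Inverse)
open import Relation.Nullary using (¬_; does)
open import Relation.Binary.PropositionalEquality as ≡ using (_≡_)
open import Algebra.Bundles using (CommutativeRing)
open import Data.Bool using (if_then_else_)

record FiniteField (c ℓ : Level) : Set (Level.suc (c ⊔ ℓ)) where
  field
    cring   : CommutativeRing c ℓ
  open CommutativeRing cring public
  field
    q       : ℕ
    enum    : Inverse (≡.setoid (Fin q)) setoid
    1≉0     : ¬ (1# ≈ 0#)
    inverse : ∀ x → ¬ (x ≈ 0#) → ∃ λ y → x * y ≈ 1#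

module _ {c ℓ : Level} (k : FiniteField c ℓ) where
  open FiniteField k
  open import Algebra.Bundles using (Semiring)
  open import Algebra.Definitions.RawSemiring (Semiring.rawSemiring semiring) using (_^_)

  pow : Carrier → ℕ → Carrier
  pow = _^_

  μ[_] : ℕ → Carrier → Set ℓ
  μ[ n ] ζ = ζ ^ n ≈ 1#

  record IsAut (n : ℕ) (f : Carrier → Carrier) : Set (c ⊔ ℓ) where
    field
      cong       : ∀ {x y} → x ≈ y → f x ≈ f y
      injective  : ∀ {x y} → f x ≈ f y → x ≈ y
      surjective : ∀ y → ∃ λ x → f x ≈ y
      pointed    : f 0# ≈ 0#
      equivar    : ∀ ζ x → μ[ n ] ζ → f (ζ * x) ≈ ζ * f x

  record IsOrbitReps (n t : ℕ) (x : Fin t → Carrier) : Set (c ⊔ ℓ) where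
    field
      nonzero  : ∀ i → ¬ (x i ≈ 0#)
      covers   : ∀ y → ¬ (y ≈ 0#) → ∃ λ ζ → ∃ λ i → μ[ n ] ζ × y ≈ ζ * x i
      distinct : ∀ i j ζ → μ[ n ] ζ → x i ≈ ζ * x j → i ≡ j

  Decomposes : (n t : ℕ) → (Carrier → Carrier) → (Fin t → Carrier) →
               (Fin t → Carrier) → (Fin t → Fin t) → Set ℓ
  Decomposes n t f x μf σf = ∀ i → μ[ n ] (μf i) × f (x i) ≈ μf i * x (σf i)

  prod : ∀ {t} → (Fin t → Carrier) → Carrier
  prod {zero}  v = 1#
  prod {suc t} v = v Fin.zero * prod (λ i → v (Fin.suc i))

  m[_] : Carrier → Carrier → Carrier
  m[ a ] x = x * a

count : ∀ {t} → (Fin t → ℕ) → ℕ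
count {zero}  v = 0
count {suc t} v = v Fin.zero ℕ.+ count (λ i → v (Fin.suc i))

inversions : ∀ {t} → (Fin t → Fin t) → ℕ
inversions σ = count λ i → count λ j →
  if does (i <? j) then (if does (σ j <? σ i) then 1 else 0) else 0

sgn : ∀ {t} → (Fin t → Fin t) → Sign
sgn σ = if does (inversions σ % 2 ℕ.≟ 0) then Sign.+ else Sign.-

-- Image of f in Aut(k)^ab ≅ μ_n × {±1}, computed from the decomposition
-- data (μ_f, σ_f) w.r.t. orbit representatives: (∏ μ_f(i), sgn σ_f).
module _ {c ℓ : Level} (k : FiniteField c ℓ) where
  open FiniteField k
  abImage : ∀ {t} → (Fin t → Carrier) → (Fin t → Fin t) → Carrier × Sign
  abImage μf σf = prod k μf , sgn σf

-- Writing x_i a = μ_i x_{σ i} and multiplying over all orbit representatives gives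
-- a^t ∏ x_i = ∏ μ_i ∏ x_{σ i}; as σ is a permutation, ∏ μ_i = a^t, where t is the number
-- of orbits. It remains to show t = (q - 1)/n. The same identity for any b ≠ 0 gives
-- b^{tn} = (∏ μ_i(b))^n = 1, so the q - 1 units are roots of X^{tn} - 1 and q - 1 ≤ tn.
-- Conversely the x_i^n are pairwise distinct (the x_i lie in distinct orbits) roots of
-- X^{(q-1)/n} - 1 by Fermat's little theorem, so t ≤ (q - 1)/n. Both bounds only use
-- that a polynomial over a field has at most as many roots as its degree.
module Submission where

open import Defs
open import Level using (_⊔_)
open import Data.Nat as ℕ using (ℕ; zero; suc; _∸_; _/_; NonZero; z≤n; s≤s)
import Data.Nat.Properties as ℕ
open import Data.Nat.DivMod using (m*n/n≡m)
open import Data.Nat.Divisibility using (_∣_; divides)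
open import Data.Fin as Fin using (Fin; punchOut)
import Data.Fin.Properties as Fin
open import Data.Fin.Permutation using (permutation)
open import Data.Vec using (Vec; []; _∷_; replicate)
open import Data.Product using (∃; _×_; _,_; proj₁; proj₂)
open import Data.Sign using (Sign)
open import Data.Empty using (⊥-elim)
open import Function.Base using (_∘_)
open import Function.Bundles using (Inverse; Injection)
open import Function.Properties.Inverse using (Inverse⇒Injection)
open import Function.Definitions using (Injective)
open import Relation.Nullary using (¬_; yes; no)
open import Relation.Binary.PropositionalEquality as ≡ using (_≡_)
open import Algebra.Bundles using (CommutativeRing)

injective⇒surjective : ∀ {t} (σ : Fin t → Fin t) → Injective _≡_ _≡_ σ → ∀ j → ∃ λ i → σ i ≡ j
injective⇒surjective {zero}  σ σ-inj ()
injective⇒surjective {suc t} σ σ-inj j with Fin.any? (λ i → σ i Fin.≟ j)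
... | yes hit = hit
... | no miss = ⊥-elim (ℕ.1+n≰n (Fin.injective⇒≤ avoid-j-injective))
  where
  avoid-j : Fin (suc t) → Fin t
  avoid-j i = punchOut {i = j} {j = σ i} (λ j≡σi → miss (i , ≡.sym j≡σi))
  avoid-j-injective : Injective _≡_ _≡_ avoid-j
  avoid-j-injective {a} {b} =
    σ-inj ∘ Fin.punchOut-injective (λ e → miss (a , ≡.sym e)) (λ e → miss (b , ≡.sym e))

module MonicPolynomial {c ℓ} (R : CommutativeRing c ℓ) where
  open CommutativeRing R
  open import Relation.Binary.Reasoning.Setoid setoid
  open import Algebra.Solver.Ring.NaturalCoefficients.Default commutativeSemiring
    using (solve; _:+_; _:*_; _:=_; con)
  open import Algebra.Properties.Semiring.Exp semiring using (_^_)
  open import Algebra.Properties.Group +-group using (//-rightDividesˡ)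

  -- a ∷ p stands for X · p + a, and [] for 1: a vector of length m is a monic polynomial of degree m.
  Monic : ℕ → Set c
  Monic = Vec Carrier

  eval : ∀ {m} → Monic m → Carrier → Carrier
  eval []      x = 1#
  eval (a ∷ p) x = x * eval p x + a

  divByLinear : ∀ {m} → Monic (suc m) → Carrier → Monic m
  divByLinear (a ∷ [])    r = []
  divByLinear (a ∷ b ∷ p) r = eval (b ∷ p) r ∷ divByLinear (b ∷ p) r

  -- The semiring solver cannot subtract, so x is first rewritten as (x - r) + r.
  eval-divByLinear : ∀ {m} (p : Monic (suc m)) r x →
                     eval p x ≈ (x - r) * eval (divByLinear p r) x + eval p r
  eval-divByLinear (a ∷ []) r x = begin
    x * 1# + a                 ≈⟨ +-congʳ (*-congʳ (//-rightDividesˡ r x)) ⟨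
    ((x - r) + r) * 1# + a     ≈⟨ shift (x - r) r a ⟩
    (x - r) * 1# + (r * 1# + a) ∎
    where
    shift : ∀ d r a → (d + r) * 1# + a ≈ d * 1# + (r * 1# + a)
    shift = solve 3 (λ d r a → (d :+ r) :* con 1 :+ a := d :* con 1 :+ (r :* con 1 :+ a)) refl
  eval-divByLinear (a ∷ b ∷ p) r x = begin
    x * eval (b ∷ p) x + a                 ≈⟨ +-congʳ (*-congˡ (eval-divByLinear (b ∷ p) r x)) ⟩
    x * ((x - r) * Q + e) + a              ≈⟨ +-congʳ (*-congʳ (//-rightDividesˡ r x)) ⟨
    ((x - r) + r) * ((x - r) * Q + e) + a  ≈⟨ shift (x - r) r Q e a ⟩
    (x - r) * (((x - r) + r) * Q + e) + (r * e + a)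
      ≈⟨ +-congʳ (*-congˡ (+-congʳ (*-congʳ (//-rightDividesˡ r x)))) ⟩
    (x - r) * (x * Q + e) + (r * e + a)    ∎
    where
    Q = eval (divByLinear (b ∷ p) r) x
    e = eval (b ∷ p) r
    shift : ∀ d r q e a → (d + r) * (d * q + e) + a ≈ d * ((d + r) * q + e) + (r * e + a)
    shift = solve 5 (λ d r q e a →
      (d :+ r) :* (d :* q :+ e) :+ a := d :* ((d :+ r) :* q :+ e) :+ (r :* e :+ a)) refl

  eval-X^m-1 : ∀ m x → eval (- 1# ∷ replicate m 0#) x ≈ x ^ suc m - 1#
  eval-X^m-1 m x = +-congʳ (*-congˡ (eval-X^m m))
    where
    eval-X^m : ∀ m → eval (replicate m 0#) x ≈ x ^ m
    eval-X^m zero    = refl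
    eval-X^m (suc m) = trans (+-identityʳ _) (*-congˡ (eval-X^m m))

  module RootBound (1≉0 : ¬ 1# ≈ 0#) (x*y≈0⇒y≈0 : ∀ {x y} → ¬ x ≈ 0# → x * y ≈ 0# → y ≈ 0#) where
    roots≤degree : ∀ {m s} (p : Monic m) (r : Fin s → Carrier) → Injective _≡_ _≈_ r →
                   (∀ j → eval p (r j) ≈ 0#) → s ℕ.≤ m
    roots≤degree {s = zero}          p  r r-inj roots = z≤n
    roots≤degree {zero}  {suc s}     [] r r-inj roots = ⊥-elim (1≉0 (roots Fin.zero))
    roots≤degree {suc m} {suc s}     p  r r-inj roots =
      s≤s (roots≤degree (divByLinear p r₀) (r ∘ Fin.suc) (Fin.suc-injective ∘ r-inj) quotient-roots)
      where
      r₀ = r Fin.zero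
      quotient-roots : ∀ j → eval (divByLinear p r₀) (r (Fin.suc j)) ≈ 0#
      quotient-roots j = x*y≈0⇒y≈0 y-r₀≉0 (begin
        (y - r₀) * eval (divByLinear p r₀) y            ≈⟨ +-identityʳ _ ⟨
        (y - r₀) * eval (divByLinear p r₀) y + 0#       ≈⟨ +-congˡ (roots Fin.zero) ⟨
        (y - r₀) * eval (divByLinear p r₀) y + eval p r₀ ≈⟨ eval-divByLinear p r₀ y ⟨
        eval p y                                        ≈⟨ roots (Fin.suc j) ⟩
        0#                                              ∎)
        where
        y = r (Fin.suc j)
        y-r₀≉0 : ¬ y - r₀ ≈ 0#
        y-r₀≉0 e with r-inj (begin
          y              ≈⟨ //-rightDividesˡ r₀ y ⟨
          (y - r₀) + r₀  ≈⟨ +-congʳ e ⟩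
          0# + r₀        ≈⟨ +-identityˡ r₀ ⟩
          r₀             ∎)
        ... | ()

    rootsOfUnity≤ : ∀ m .{{_ : NonZero m}} {s} (r : Fin s → Carrier) → Injective _≡_ _≈_ r →
                    (∀ j → r j ^ m ≈ 1#) → s ℕ.≤ m
    rootsOfUnity≤ (suc m) r r-inj r^m≈1 = roots≤degree (- 1# ∷ replicate m 0#) r r-inj (λ j → begin
      eval (- 1# ∷ replicate m 0#) (r j) ≈⟨ eval-X^m-1 m (r j) ⟩
      r j ^ suc m - 1#                   ≈⟨ +-congʳ (r^m≈1 j) ⟩
      1# - 1#                            ≈⟨ -‿inverseʳ 1# ⟩
      0#                                 ∎)

module FiniteFieldFacts {c ℓ} (k : FiniteField c ℓ) where
  open FiniteField k
  open import Relation.Binary.Reasoning.Setoid setoid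
  open import Algebra.Properties.CommutativeSemiring.Exp commutativeSemiring
    using (_^_; ^-congˡ; ^-assocʳ; ^-distrib-*)
  open import Algebra.Properties.CommutativeMonoid.Sum *-commutativeMonoid
    using (sum; sum-cong-≋; sum-replicate; ∑-distrib-+; sum-permute)
  open import Algebra.Solver.Ring.NaturalCoefficients.Default commutativeSemiring
    using (solve; _:*_; _:=_)

  infix 8 _⁻¹⟨_⟩
  _⁻¹⟨_⟩ : ∀ x → ¬ x ≈ 0# → Carrier
  x ⁻¹⟨ x≉0 ⟩ = proj₁ (inverse x x≉0)

  x*x⁻¹≈1 : ∀ x (x≉0 : ¬ x ≈ 0#) → x * x ⁻¹⟨ x≉0 ⟩ ≈ 1#
  x*x⁻¹≈1 x x≉0 = proj₂ (inverse x x≉0)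

  x⁻¹*x≈1 : ∀ x (x≉0 : ¬ x ≈ 0#) → x ⁻¹⟨ x≉0 ⟩ * x ≈ 1#
  x⁻¹*x≈1 x x≉0 = trans (*-comm _ x) (x*x⁻¹≈1 x x≉0)

  x*y≈0⇒y≈0 : ∀ {x y} → ¬ x ≈ 0# → x * y ≈ 0# → y ≈ 0#
  x*y≈0⇒y≈0 {x} {y} x≉0 xy≈0 = begin
    y                      ≈⟨ *-identityˡ y ⟨
    1# * y                 ≈⟨ *-congʳ (x⁻¹*x≈1 x x≉0) ⟨
    (x ⁻¹⟨ x≉0 ⟩ * x) * y  ≈⟨ *-assoc _ x y ⟩
    x ⁻¹⟨ x≉0 ⟩ * (x * y)  ≈⟨ *-congˡ xy≈0 ⟩
    x ⁻¹⟨ x≉0 ⟩ * 0#       ≈⟨ zeroʳ _ ⟩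
    0#                     ∎

  *-≉0 : ∀ {x y} → ¬ x ≈ 0# → ¬ y ≈ 0# → ¬ x * y ≈ 0#
  *-≉0 x≉0 y≉0 = y≉0 ∘ x*y≈0⇒y≈0 x≉0

  *-cancelʳ : ∀ {a} → ¬ a ≈ 0# → ∀ {x y} → x * a ≈ y * a → x ≈ y
  *-cancelʳ {a} a≉0 {x} {y} xa≈ya = begin
    x                         ≈⟨ *-identityʳ x ⟨
    x * 1#                    ≈⟨ *-congˡ (x*x⁻¹≈1 a a≉0) ⟨
    x * (a * a ⁻¹⟨ a≉0 ⟩)     ≈⟨ *-assoc x a _ ⟨
    (x * a) * a ⁻¹⟨ a≉0 ⟩     ≈⟨ *-congʳ xa≈ya ⟩
    (y * a) * a ⁻¹⟨ a≉0 ⟩     ≈⟨ *-assoc y a _ ⟩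
    y * (a * a ⁻¹⟨ a≉0 ⟩)     ≈⟨ *-congˡ (x*x⁻¹≈1 a a≉0) ⟩
    y * 1#                    ≈⟨ *-identityʳ y ⟩
    y                         ∎

  open MonicPolynomial.RootBound cring 1≉0 x*y≈0⇒y≈0 using (rootsOfUnity≤)

  1^n≈1 : ∀ n → 1# ^ n ≈ 1#
  1^n≈1 zero    = refl
  1^n≈1 (suc n) = trans (*-identityˡ _) (1^n≈1 n)

  μ-* : ∀ n {ζ ξ} → μ[ k ] n ζ → μ[ k ] n ξ → μ[ k ] n (ζ * ξ)
  μ-* n {ζ} {ξ} ζ^n≈1 ξ^n≈1 = begin
    (ζ * ξ) ^ n    ≈⟨ ^-distrib-* ζ ξ n ⟩
    ζ ^ n * ξ ^ n  ≈⟨ *-cong ζ^n≈1 ξ^n≈1 ⟩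
    1# * 1#        ≈⟨ *-identityˡ 1# ⟩
    1#             ∎

  μ-inverse : ∀ n {ζ ξ} → ξ * ζ ≈ 1# → μ[ k ] n ζ → μ[ k ] n ξ
  μ-inverse n {ζ} {ξ} ξζ≈1 ζ^n≈1 = begin
    ξ ^ n          ≈⟨ *-identityʳ _ ⟨
    ξ ^ n * 1#     ≈⟨ *-congˡ ζ^n≈1 ⟨
    ξ ^ n * ζ ^ n  ≈⟨ ^-distrib-* ξ ζ n ⟨
    (ξ * ζ) ^ n    ≈⟨ ^-congˡ n ξζ≈1 ⟩
    1# ^ n         ≈⟨ 1^n≈1 n ⟩
    1#             ∎

  μ-≉0 : ∀ n .{{_ : NonZero n}} {ζ} → μ[ k ] n ζ → ¬ ζ ≈ 0#
  μ-≉0 (suc n) {ζ} ζ^n≈1 ζ≈0 = 1≉0 (begin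
    1#            ≈⟨ ζ^n≈1 ⟨
    ζ * ζ ^ n     ≈⟨ *-congʳ ζ≈0 ⟩
    0# * ζ ^ n    ≈⟨ zeroˡ _ ⟩
    0#            ∎)

  prod≡sum : ∀ {t} (v : Fin t → Carrier) → prod k v ≡ sum v
  prod≡sum {zero}  v = ≡.refl
  prod≡sum {suc t} v = ≡.cong (v Fin.zero *_) (prod≡sum (v ∘ Fin.suc))

  prod-cong : ∀ {t} {v w : Fin t → Carrier} → (∀ i → v i ≈ w i) → prod k v ≈ prod k w
  prod-cong {v = v} {w} v≈w = begin
    prod k v  ≡⟨ prod≡sum v ⟩
    sum v     ≈⟨ sum-cong-≋ v≈w ⟩
    sum w     ≡⟨ prod≡sum w ⟨
    prod k w  ∎

  prod-const : ∀ t a → prod k {t} (λ _ → a) ≈ a ^ t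
  prod-const t a = trans (reflexive (prod≡sum {t} (λ _ → a))) (sum-replicate t)

  prod-distrib-* : ∀ {t} (v w : Fin t → Carrier) → prod k (λ i → v i * w i) ≈ prod k v * prod k w
  prod-distrib-* v w = begin
    prod k (λ i → v i * w i)  ≡⟨ prod≡sum (λ i → v i * w i) ⟩
    sum (λ i → v i * w i)     ≈⟨ ∑-distrib-+ v w ⟩
    sum v * sum w             ≡⟨ ≡.cong₂ _*_ (prod≡sum v) (prod≡sum w) ⟨
    prod k v * prod k w       ∎

  prod-permute : ∀ {t} (v : Fin t → Carrier) (σ : Fin t → Fin t) → Injective _≡_ _≡_ σ →
                 prod k v ≈ prod k (v ∘ σ)
  prod-permute v σ σ-inj = begin
    prod k v        ≡⟨ prod≡sum v ⟩
    sum v           ≈⟨ sum-permute v π ⟩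
    sum (v ∘ σ)     ≡⟨ prod≡sum (v ∘ σ) ⟨
    prod k (v ∘ σ)  ∎
    where
    σ⁻¹ = λ j → proj₁ (injective⇒surjective σ σ-inj j)
    π = permutation σ σ⁻¹ (λ j → proj₂ (injective⇒surjective σ σ-inj j))
                          (λ i → σ-inj (proj₂ (injective⇒surjective σ σ-inj (σ i))))

  prod-≉0 : ∀ {t} (v : Fin t → Carrier) → (∀ i → ¬ v i ≈ 0#) → ¬ prod k v ≈ 0#
  prod-≉0 {zero}  v v≉0 = 1≉0
  prod-≉0 {suc t} v v≉0 = *-≉0 (v≉0 Fin.zero) (prod-≉0 (v ∘ Fin.suc) (v≉0 ∘ Fin.suc))

  μ-prod : ∀ n {t} (v : Fin t → Carrier) → (∀ i → μ[ k ] n (v i)) → μ[ k ] n (prod k v)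
  μ-prod n {zero}  v v∈μ = 1^n≈1 n
  μ-prod n {suc t} v v∈μ = μ-* n (v∈μ Fin.zero) (μ-prod n (v ∘ Fin.suc) (v∈μ ∘ Fin.suc))

  prod-factors≈^ : ∀ {t} (v w : Fin t → Carrier) (σ : Fin t → Fin t) {a} →
                   (∀ i → ¬ v i ≈ 0#) → Injective _≡_ _≡_ σ →
                   (∀ i → v i * a ≈ w i * v (σ i)) → prod k w ≈ a ^ t
  prod-factors≈^ {t} v w σ {a} v≉0 σ-inj va≈wvσ = *-cancelʳ (prod-≉0 v v≉0) (begin
    prod k w * prod k v               ≈⟨ *-congˡ (prod-permute v σ σ-inj) ⟩
    prod k w * prod k (v ∘ σ)         ≈⟨ prod-distrib-* w (v ∘ σ) ⟨
    prod k (λ i → w i * v (σ i))      ≈⟨ prod-cong va≈wvσ ⟨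
    prod k (λ i → v i * a)            ≈⟨ prod-distrib-* v (λ _ → a) ⟩
    prod k v * prod k {t} (λ _ → a)   ≈⟨ *-congˡ (prod-const t a) ⟩
    prod k v * a ^ t                  ≈⟨ *-comm _ _ ⟩
    a ^ t * prod k v                  ∎)

  record UnitEnumeration (u : ℕ) : Set (c ⊔ ℓ) where
    field
      unit      : Fin u → Carrier
      injective : Injective _≡_ _≈_ unit
      unit≉0    : ∀ i → ¬ unit i ≈ 0#
      complete  : ∀ y → ¬ y ≈ 0# → ∃ λ i → unit i ≈ y

  removeZero : ∀ {Q} → Inverse (≡.setoid (Fin Q)) setoid → UnitEnumeration (Q ∸ 1)
  removeZero {zero}  e with Inverse.from e 0#
  ... | ()
  removeZero {suc Q} e = record
    { unit      = to ∘ Fin.punchIn z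
    ; injective = Fin.punchIn-injective z _ _ ∘ Injection.injective (Inverse⇒Injection e)
    ; unit≉0    = λ i → Fin.punchInᵢ≢i z i ∘ ≡.trans (≡.sym (Inverse.strictlyInverseʳ e _)) ∘ from-cong
    ; complete  = λ y y≉0 → punchOut (z≢from y y≉0) , (begin
        to (Fin.punchIn z (punchOut (z≢from y y≉0)))  ≡⟨ ≡.cong to (Fin.punchIn-punchOut _) ⟩
        to (from y)                                  ≈⟨ Inverse.strictlyInverseˡ e y ⟩
        y                                            ∎)
    }
    where
    open Inverse e using (to; from; from-cong)
    z = from 0#
    z≢from : ∀ y → ¬ y ≈ 0# → ¬ z ≡ from y
    z≢from y y≉0 z≡y = y≉0 (begin
      y            ≈⟨ Inverse.strictlyInverseˡ e y ⟨
      to (from y)  ≡⟨ ≡.cong to z≡y ⟨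
      to z         ≈⟨ Inverse.strictlyInverseˡ e 0# ⟩
      0#           ∎)

  units : UnitEnumeration (q ∸ 1)
  units = removeZero enum

  open UnitEnumeration units

  -- Multiplication by y permutes the units, with all factors equal to 1.
  fermat : ∀ {y} → ¬ y ≈ 0# → y ^ (q ∸ 1) ≈ 1#
  fermat {y} y≉0 = begin
    y ^ (q ∸ 1)                     ≈⟨ prod-factors≈^ unit (λ _ → 1#) σ unit≉0 σ-inj unit*y≈1*unit ⟨
    prod k {q ∸ 1} (λ _ → 1#)       ≈⟨ prod-const (q ∸ 1) 1# ⟩
    1# ^ (q ∸ 1)                    ≈⟨ 1^n≈1 (q ∸ 1) ⟩
    1#                              ∎
    where
    image : ∀ i → ∃ λ j → unit j ≈ unit i * y
    image i = complete (unit i * y) (*-≉0 (unit≉0 i) y≉0)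
    σ = λ i → proj₁ (image i)
    unit*y≈1*unit : ∀ i → unit i * y ≈ 1# * unit (σ i)
    unit*y≈1*unit i = trans (sym (proj₂ (image i))) (sym (*-identityˡ _))
    σ-inj : Injective _≡_ _≡_ σ
    σ-inj {i} {j} σi≡σj = injective (*-cancelʳ y≉0 (begin
      unit i * y  ≈⟨ proj₂ (image i) ⟨
      unit (σ i)  ≡⟨ ≡.cong unit σi≡σj ⟩
      unit (σ j)  ≈⟨ proj₂ (image j) ⟩
      unit j * y  ∎))

  m[a]-isAut : ∀ n {a} → ¬ a ≈ 0# → IsAut k n (m[ k ] a)
  m[a]-isAut n {a} a≉0 = record
    { cong       = *-congʳ
    ; injective  = *-cancelʳ a≉0
    ; surjective = λ y → y * a ⁻¹⟨ a≉0 ⟩ , (begin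
        (y * a ⁻¹⟨ a≉0 ⟩) * a  ≈⟨ *-assoc y _ a ⟩
        y * (a ⁻¹⟨ a≉0 ⟩ * a)  ≈⟨ *-congˡ (x⁻¹*x≈1 a a≉0) ⟩
        y * 1#                 ≈⟨ *-identityʳ y ⟩
        y                      ∎)
    ; pointed    = zeroˡ a
    ; equivar    = λ ζ x _ → *-assoc ζ x a
    }

  module OrbitRepresentatives (n : ℕ) .{{_ : NonZero n}} {t} {x : Fin t → Carrier}
                              (reps : IsOrbitReps k n t x) where
    open IsOrbitReps reps

    decomposition : ∀ {b} → ¬ b ≈ 0# → ∃ λ μf → ∃ λ σf → Decomposes k n t (m[ k ] b) x μf σf
    decomposition {b} b≉0 = (λ i → proj₁ (orbit i)) , (λ i → proj₁ (proj₂ (orbit i))) ,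
                            λ i → proj₂ (proj₂ (orbit i))
      where
      orbit = λ i → covers (x i * b) (*-≉0 (nonzero i) b≉0)

    decomposition-injective : ∀ {b μf σf} → ¬ b ≈ 0# → Decomposes k n t (m[ k ] b) x μf σf →
                              Injective _≡_ _≡_ σf
    decomposition-injective {b} {μf} {σf} b≉0 dec {i} {j} σi≡σj =
      distinct i j ζ ζ∈μ (*-cancelʳ b≉0 (begin
        x i * b                          ≈⟨ proj₂ (dec i) ⟩
        μf i * x (σf i)                  ≈⟨ *-congˡ (*-identityˡ _) ⟨
        μf i * (1# * x (σf i))           ≈⟨ *-congˡ (*-congʳ (x⁻¹*x≈1 (μf j) μj≉0)) ⟨
        μf i * ((μj⁻¹ * μf j) * x (σf i)) ≈⟨ reassoc (μf i) μj⁻¹ (μf j) (x (σf i)) ⟩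
        ζ * (μf j * x (σf i))            ≡⟨ ≡.cong (λ l → ζ * (μf j * x l)) σi≡σj ⟩
        ζ * (μf j * x (σf j))            ≈⟨ *-congˡ (proj₂ (dec j)) ⟨
        ζ * (x j * b)                    ≈⟨ *-assoc ζ (x j) b ⟨
        (ζ * x j) * b                    ∎))
      where
      μj≉0 = μ-≉0 n (proj₁ (dec j))
      μj⁻¹ = μf j ⁻¹⟨ μj≉0 ⟩
      ζ = μf i * μj⁻¹
      ζ∈μ : μ[ k ] n ζ
      ζ∈μ = μ-* n (proj₁ (dec i)) (μ-inverse n (x⁻¹*x≈1 (μf j) μj≉0) (proj₁ (dec j)))
      reassoc : ∀ a b c y → a * ((b * c) * y) ≈ (a * b) * (c * y)
      reassoc = solve 4 (λ a b c y → a :* ((b :* c) :* y) := (a :* b) :* (c :* y)) refl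

    prod-decomposition : ∀ {b μf σf} → ¬ b ≈ 0# → Decomposes k n t (m[ k ] b) x μf σf →
                         prod k μf ≈ b ^ t
    prod-decomposition b≉0 dec =
      prod-factors≈^ x _ _ nonzero (decomposition-injective b≉0 dec) (proj₂ ∘ dec)

    ^[t*n]≈1 : ∀ {b} → ¬ b ≈ 0# → b ^ (t ℕ.* n) ≈ 1#
    ^[t*n]≈1 {b} b≉0 with μf , σf , dec ← decomposition b≉0 = begin
      b ^ (t ℕ.* n)  ≈⟨ ^-assocʳ b t n ⟨
      (b ^ t) ^ n    ≈⟨ ^-congˡ n (prod-decomposition b≉0 dec) ⟨
      prod k μf ^ n  ≈⟨ μ-prod n μf (proj₁ ∘ dec) ⟩
      1#             ∎

    q-1≤t*n : q ∸ 1 ℕ.≤ t ℕ.* n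
    q-1≤t*n = rootsOfUnity≤ (t ℕ.* n) {{ℕ.m*n≢0 t n {{t≢0}}}} unit injective (^[t*n]≈1 ∘ unit≉0)
      where
      t≢0 : NonZero t
      t≢0 = Fin.nonZeroIndex (proj₁ (proj₂ (covers 1# 1≉0)))

    ^n-injective : Injective _≡_ _≈_ (λ i → x i ^ n)
    ^n-injective {i} {j} xi^n≈xj^n = distinct i j ζ ζ∈μ (begin
      x i                      ≈⟨ *-identityʳ (x i) ⟨
      x i * 1#                 ≈⟨ *-congˡ (x⁻¹*x≈1 (x j) (nonzero j)) ⟨
      x i * (xj⁻¹ * x j)       ≈⟨ *-assoc (x i) xj⁻¹ (x j) ⟨
      ζ * x j                  ∎)
      where
      xj⁻¹ = x j ⁻¹⟨ nonzero j ⟩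
      ζ = x i * xj⁻¹
      ζ∈μ : μ[ k ] n ζ
      ζ∈μ = begin
        (x i * xj⁻¹) ^ n       ≈⟨ ^-distrib-* (x i) xj⁻¹ n ⟩
        x i ^ n * xj⁻¹ ^ n     ≈⟨ *-congʳ xi^n≈xj^n ⟩
        x j ^ n * xj⁻¹ ^ n     ≈⟨ ^-distrib-* (x j) xj⁻¹ n ⟨
        (x j * xj⁻¹) ^ n       ≈⟨ ^-congˡ n (x*x⁻¹≈1 (x j) (nonzero j)) ⟩
        1# ^ n                 ≈⟨ 1^n≈1 n ⟩
        1#                     ∎

    t≤d : ∀ {d} → q ∸ 1 ≡ d ℕ.* n → t ℕ.≤ d
    t≤d {d} q-1≡d*n = rootsOfUnity≤ d {{d≢0}} (λ i → x i ^ n) ^n-injective (λ i → begin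
      (x i ^ n) ^ d   ≈⟨ ^-assocʳ (x i) n d ⟩
      x i ^ (n ℕ.* d) ≡⟨ ≡.cong (x i ^_) (ℕ.*-comm n d) ⟩
      x i ^ (d ℕ.* n) ≡⟨ ≡.cong (x i ^_) q-1≡d*n ⟨
      x i ^ (q ∸ 1)   ≈⟨ fermat (nonzero i) ⟩
      1#              ∎)
      where
      d≢0 : NonZero d
      d≢0 = ℕ.m*n≢0⇒m≢0 d {{≡.subst NonZero q-1≡d*n (Fin.nonZeroIndex (proj₁ (complete 1# 1≉0)))}}

    orbitCount : n ∣ q ∸ 1 → t ≡ (q ∸ 1) / n
    orbitCount (divides d q-1≡d*n) = ≡.trans t≡d (≡.sym [q-1]/n≡d)
      where
      d*n≤t*n = ℕ.≤-trans (ℕ.≤-reflexive (≡.sym q-1≡d*n)) q-1≤t*n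
      t≡d = ℕ.≤-antisym (t≤d q-1≡d*n) (ℕ.*-cancelʳ-≤ d t n d*n≤t*n)
      [q-1]/n≡d = ≡.trans (≡.cong (_/ n) q-1≡d*n) (m*n/n≡m d n)

mainTheorem7 : ∀ {c ℓ} (k : FiniteField c ℓ) (n : ℕ) .{{_ : NonZero n}} →
    n ∣ (FiniteField.q k ∸ 1) →
    (a : FiniteField.Carrier k) → ¬ (FiniteField._≈_ k a (FiniteField.0# k)) →
    IsAut k n (m[_] k a)
    × (∀ (t : ℕ) (x : Fin t → FiniteField.Carrier k) → IsOrbitReps k n t x →
        (∃ λ μf → ∃ λ σf → Decomposes k n t (m[_] k a) x μf σf)
        × (∀ μf σf → Decomposes k n t (m[_] k a) x μf σf →
            ∃ λ (ε : Sign) →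
              FiniteField._≈_ k (proj₁ (abImage k μf σf))
                (pow k a ((FiniteField.q k ∸ 1) / n))
              × proj₂ (abImage k μf σf) ≡ ε))
mainTheorem7 k n n∣q-1 a a≉0 = m[a]-isAut n a≉0 , λ t x reps →
  let open OrbitRepresentatives n reps
      t≡[q-1]/n = orbitCount n∣q-1
  in  decomposition a≉0 , λ μf σf dec →
        sgn σf , trans (prod-decomposition a≉0 dec) (reflexive (≡.cong (pow k a) t≡[q-1]/n)) , ≡.refl
  where
  open FiniteField k using (trans; reflexive)
  open FiniteFieldFacts k
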